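{- For all integers $0\le r\le n$, the poset $(S(n,r),\sqsubseteq)$ is a distributive lattice; its meet and join are the componentwise minimum and maximum (with respect to $\preceq$) of strings.
   Context: Fix integers $0\le r\le n$. Let $A(n,r)$ be an alphabet of $n+1$ formal symbols $\tilde 1,\dots,\tilde r,\ 0^\S,\ \bar 1,\dots,\overline{n-r}$, totally ordered by $\overline{n-r}\prec\cdots\prec\bar 2\prec\bar1\prec 0^\S\prec\tilde1\prec\tilde 2\prec\cdots\prec\tilde r$. Let $S(n,r)$ be the set of strings $w=i_1\cdots i_r\,|\,j_1\cdots j_{n-r}$ with $i_1,\dots,i_r\in\{\tilde1,\dots,\tilde r,0^\S\}$ and $j_1,\dots,j_{n-r}\in\{0^\S,\bar1,\dots,\overline{n-r}\}$ such that for some $0\le p\le r$ and $1\le q\le n-r+1$ one has $i_1\succ i_2\succ\cdots\succ i_p\succ 0^\S$, $i_{p+1}=\cdots=i_r=0^\S$, $j_1=\cdots=j_{q-1}=0^\S$ and $0^\S\succ j_q\succ\cdots\succ j_{n-r}$. (So a string is determined by its set of symbols different from $0^\S$, and every subset of $A(n,r)\setminus\{0^\S\}$ is the set of non-$0^\S$ symbols of exactly one string.) $S(n,r)$ is ordered componentwise: $w\sqsubseteq w'$ iff the symbol of $w$ in each position is $\preceq$ the symbol of $w'$ in that position. $S(0,0)$ consists of a single (empty) string. -}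

module Defs where

open import Data.Nat using (ℕ; zero; suc; _∸_; _≤_; _<_; _≤ᵇ_)
open import Data.Fin using (Fin; toℕ)
open import Data.Bool using (Bool; true; false; if_then_else_; T)
open import Data.Vec using (Vec; lookup; zipWith)
open import Data.Product using (Σ; Σ-syntax; _×_; proj₁)
open import Relation.Binary.PropositionalEquality using (_≡_)
open import Relation.Nullary using (¬_)
open import Data.Unit using (⊤)
open import Data.Empty using (⊥)

-- The alphabet A(n,r):  tilde k  stands for  \tilde{k+1}  (k : Fin r),
-- zeroS stands for 0^§, and  bar k  stands for  \bar{k+1}  (k : Fin (n ∸ r)).
data Sym (n r : ℕ) : Set where
  tilde : Fin r → Sym n r
  zeroS : Sym n r
  bar   : Fin (n ∸ r) → Sym n r

-- The total order ≼ :  bar(n-r) ≺ ... ≺ bar 1 ≺ 0^§ ≺ tilde 1 ≺ ... ≺ tilde r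
-- (as a boolean test, and its propositional version).
_≼ᵇ_ : ∀ {n r} → Sym n r → Sym n r → Bool
bar i   ≼ᵇ bar j   = toℕ j ≤ᵇ toℕ i
bar i   ≼ᵇ zeroS   = true
bar i   ≼ᵇ tilde j = true
zeroS   ≼ᵇ bar j   = false
zeroS   ≼ᵇ zeroS   = true
zeroS   ≼ᵇ tilde j = true
tilde i ≼ᵇ bar j   = false
tilde i ≼ᵇ zeroS   = false
tilde i ≼ᵇ tilde j = toℕ i ≤ᵇ toℕ j

_≼_ : ∀ {n r} → Sym n r → Sym n r → Set
a ≼ b = T (a ≼ᵇ b)

_≺_ : ∀ {n r} → Sym n r → Sym n r → Set
a ≺ b = (a ≼ b) × ¬ (a ≡ b)

minS : ∀ {n r} → Sym n r → Sym n r → Sym n r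
minS a b = if a ≼ᵇ b then a else b

maxS : ∀ {n r} → Sym n r → Sym n r → Sym n r
maxS a b = if a ≼ᵇ b then b else a

-- Raw strings  i_1 ... i_r | j_1 ... j_{n-r}  over A(n,r)
-- (position a (1-based) is stored at Fin index a-1).
record Str (n r : ℕ) : Set where
  constructor _∣_
  field
    left  : Vec (Sym n r) r
    right : Vec (Sym n r) (n ∸ r)
open Str public

NotBar : ∀ {n r} → Sym n r → Set
NotBar (tilde _) = ⊤
NotBar zeroS     = ⊤
NotBar (bar _)   = ⊥

NotTilde : ∀ {n r} → Sym n r → Set
NotTilde (tilde _) = ⊥
NotTilde zeroS     = ⊤
NotTilde (bar _)   = ⊤

-- i_1 ≻ ... ≻ i_p ≻ 0^§ and i_{p+1} = ... = i_r = 0^§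
LeftShape : ∀ {n r} → Vec (Sym n r) r → ℕ → Set
LeftShape {n} {r} v p =
  (∀ (k l : Fin r) → toℕ l ≡ suc (toℕ k) → toℕ l < p → lookup v l ≺ lookup v k)
  × (∀ (k : Fin r) → suc (toℕ k) ≡ p → zeroS ≺ lookup v k)
  × (∀ (k : Fin r) → p ≤ toℕ k → lookup v k ≡ zeroS)

-- j_1 = ... = j_{q-1} = 0^§ and 0^§ ≻ j_q ≻ ... ≻ j_{n-r}
RightShape : ∀ {n r} → Vec (Sym n r) (n ∸ r) → ℕ → Set
RightShape {n} {r} v q =
  (∀ (k : Fin (n ∸ r)) → suc (toℕ k) < q → lookup v k ≡ zeroS)
  × (∀ (k : Fin (n ∸ r)) → suc (toℕ k) ≡ q → lookup v k ≺ zeroS)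
  × (∀ (k l : Fin (n ∸ r)) → toℕ l ≡ suc (toℕ k) → q ≤ suc (toℕ k)
       → lookup v l ≺ lookup v k)

IsS : ∀ {n r} → Str n r → Set
IsS {n} {r} w =
  (∀ (k : Fin r) → NotBar (lookup (left w) k))
  × (∀ (k : Fin (n ∸ r)) → NotTilde (lookup (right w) k))
  × (Σ[ p ∈ ℕ ] (p ≤ r × LeftShape (left w) p))
  × (Σ[ q ∈ ℕ ] (1 ≤ q × q ≤ suc (n ∸ r) × RightShape (right w) q))

S : ℕ → ℕ → Set
S n r = Σ (Str n r) IsS

_⊑_ : ∀ {n r} → Str n r → Str n r → Set
_⊑_ {n} {r} w w' =
  (∀ (k : Fin r) → lookup (left w) k ≼ lookup (left w') k)
  × (∀ (k : Fin (n ∸ r)) → lookup (right w) k ≼ lookup (right w') k)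

meetStr : ∀ {n r} → Str n r → Str n r → Str n r
meetStr w w' = zipWith minS (left w) (left w') ∣ zipWith minS (right w) (right w')

joinStr : ∀ {n r} → Str n r → Str n r → Str n r
joinStr w w' = zipWith maxS (left w) (left w') ∣ zipWith maxS (right w) (right w')

_⊑S_ : ∀ {n r} → S n r → S n r → Set
x ⊑S y = proj₁ x ⊑ proj₁ y

_≈S_ : ∀ {n r} → S n r → S n r → Set
x ≈S y = proj₁ x ≡ proj₁ y

module Submission where

-- The symbols of A(n,r) form a chain (rank embeds it into ℤ), so entrywise min and max make the
-- strings a distributive lattice, inherited from the chain.  It remains to see that S(n,r) is closed
-- under them.  A left half with parameter p is strictly decreasing and ≻ 0^§ on its first p entries
-- and 0^§ afterwards; the entrywise min of halves with parameters p, p' has parameter min p p' (a min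
-- of strictly decreasing sequences is strictly decreasing), the entrywise max has parameter max p p'
-- (an entry that has dropped to 0^§ is dominated by the other, still positive, one).  Dually, right
-- halves with parameters q, q' combine to min q q' and max q q'.

open import Defs
open import Data.Nat using (ℕ; zero; suc; _+_; _∸_; _≤_; _<_; _⊓_; _⊔_; z≤n; s≤s; s≤s⁻¹)
import Data.Nat.Properties as ℕ
open import Data.Integer as ℤ using (ℤ; +_; -[1+_]; -≤-; -≤+; +≤+)
import Data.Integer.Properties as ℤ
open import Data.Fin using (Fin; toℕ; fromℕ<)
open import Data.Fin.Properties using (toℕ-injective; toℕ-fromℕ<; toℕ<n)
open import Data.Bool using (true; false; T)
open import Data.Unit using (tt)
open import Data.Vec using (Vec; lookup; zipWith; tabulate)
open import Data.Vec.Properties using (lookup-zipWith; tabulate∘lookup; tabulate-cong; zipWith-distribˡ)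
open import Data.Product using (Σ; _×_; _,_; proj₁; proj₂)
open import Data.Sum as Sum using (_⊎_; inj₁; inj₂; [_,_]′)
open import Function using (_on_)
open import Algebra.Core using (Op₂)
open import Relation.Nullary using (yes; no)
open import Relation.Binary.Core using (Rel)
open import Relation.Binary.Bundles using (TotalOrder)
open import Relation.Binary.Structures using (IsTotalOrder; IsPartialOrder)
open import Relation.Binary.Lattice.Definitions using (Supremum; Infimum)
open import Relation.Binary.Lattice.Structures using (IsDistributiveLattice)
import Relation.Binary.Construct.On as On
open import Relation.Binary.Morphism using (IsOrderMonomorphism)
import Relation.Binary.Morphism.OrderMonomorphism as OrderMonomorphism
open import Relation.Binary.PropositionalEquality
  using (_≡_; refl; sym; trans; cong; cong₂; subst; isEquivalence; module ≡-Reasoning)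
open import Algebra.Construct.NaturalChoice.Base using (MinOperator; MaxOperator)

m⊓n≤o⇒m≤o⊎n≤o : ∀ m n {o} → m ⊓ n ≤ o → m ≤ o ⊎ n ≤ o
m⊓n≤o⇒m≤o⊎n≤o m n m⊓n≤o =
  Sum.map (λ e → subst (_≤ _) e m⊓n≤o) (λ e → subst (_≤ _) e m⊓n≤o) (ℕ.⊓-sel m n)

m<n⊔o⇒m<n⊎m<o : ∀ {m} n o → m < n ⊔ o → m < n ⊎ m < o
m<n⊔o⇒m<n⊎m<o n o m<n⊔o =
  Sum.map (λ e → subst (_ <_) e m<n⊔o) (λ e → subst (_ <_) e m<n⊔o) (ℕ.⊔-sel n o)

module _ {A : Set} where

  Lookupwise : ∀ {ℓ} → Rel A ℓ → ∀ {m} → Rel (Vec A m) ℓ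
  Lookupwise _∼_ u v = ∀ k → lookup u k ∼ lookup v k

  lookup-extensionality : ∀ {m} {u v : Vec A m} → Lookupwise _≡_ u v → u ≡ v
  lookup-extensionality {u = u} {v} u≗v = begin
    u                   ≡⟨ tabulate∘lookup u ⟨
    tabulate (lookup u) ≡⟨ tabulate-cong u≗v ⟩
    tabulate (lookup v) ≡⟨ tabulate∘lookup v ⟩
    v                   ∎
    where open ≡-Reasoning

  Lookupwise-isPartialOrder : ∀ {ℓ} {_≲_ : Rel A ℓ} → IsPartialOrder _≡_ _≲_ →
                              ∀ {m} → IsPartialOrder _≡_ (Lookupwise _≲_ {m})
  Lookupwise-isPartialOrder po = record
    { isPreorder = record
      { isEquivalence = isEquivalence
      ; reflexive     = λ { refl k → P.refl }
      ; trans         = λ u≲v v≲w k → P.trans (u≲v k) (v≲w k)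
      }
    ; antisym = λ u≲v v≲u → lookup-extensionality λ k → P.antisym (u≲v k) (v≲u k)
    }
    where module P = IsPartialOrder po

  zipWith-supremum : ∀ {ℓ} {_≲_ : Rel A ℓ} {_∙_ : Op₂ A} → Supremum _≲_ _∙_ →
                     ∀ {m} → Supremum (Lookupwise _≲_ {m}) (zipWith _∙_)
  zipWith-supremum {_≲_ = _≲_} {_∙_} sup u v = upper₁ , upper₂ , least
    where
    at : ∀ k → lookup (zipWith _∙_ u v) k ≡ lookup u k ∙ lookup v k
    at k = lookup-zipWith _∙_ k u v
    upper₁ : Lookupwise _≲_ u (zipWith _∙_ u v)
    upper₁ k = subst (lookup u k ≲_) (sym (at k)) (proj₁ (sup _ _))
    upper₂ : Lookupwise _≲_ v (zipWith _∙_ u v)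
    upper₂ k = subst (lookup v k ≲_) (sym (at k)) (proj₁ (proj₂ (sup _ _)))
    least : ∀ w → Lookupwise _≲_ u w → Lookupwise _≲_ v w → Lookupwise _≲_ (zipWith _∙_ u v) w
    least w u≲w v≲w k =
      subst (_≲ lookup w k) (sym (at k)) (proj₂ (proj₂ (sup _ _)) _ (u≲w k) (v≲w k))

  zipWith-closed : ∀ {ℓ} (P : A → Set ℓ) {_∙_ : Op₂ A} → (∀ {x y} → P x → P y → P (x ∙ y)) →
                   ∀ {m} (u v : Vec A m) → (∀ k → P (lookup u k)) → (∀ k → P (lookup v k)) →
                   ∀ k → P (lookup (zipWith _∙_ u v) k)
  zipWith-closed P {_∙_} closed u v Pu Pv k =
    subst P (sym (lookup-zipWith _∙_ k u v)) (closed (Pu k) (Pv k))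

module _ {A : Set} {P : A → Set} where

  subtypeOp : (_∙_ : Op₂ A) → (∀ x y → P x → P y → P (x ∙ y)) → Op₂ (Σ A P)
  subtypeOp _∙_ closed x y = proj₁ x ∙ proj₁ y , closed _ _ (proj₂ x) (proj₂ y)

  subtype-supremum : ∀ {ℓ} {_≲_ : Rel A ℓ} (_∙_ : Op₂ A) (closed : ∀ x y → P x → P y → P (x ∙ y)) →
                     Supremum _≲_ _∙_ → Supremum (_≲_ on proj₁) (subtypeOp _∙_ closed)
  subtype-supremum _ _ sup x y = let x≲ , y≲ , least = sup (proj₁ x) (proj₁ y) in
    x≲ , y≲ , λ z → least (proj₁ z)

-- The chain of symbols

module _ {n r : ℕ} where

  rank : Sym n r → ℤ
  rank (bar i)   = -[1+ toℕ i ]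
  rank zeroS     = + 0
  rank (tilde i) = + suc (toℕ i)

  ≼⇒rank≤ : ∀ {a b : Sym n r} → a ≼ b → rank a ℤ.≤ rank b
  ≼⇒rank≤ {bar i}   {bar j}   i≽j = -≤- (ℕ.≤ᵇ⇒≤ (toℕ j) (toℕ i) i≽j)
  ≼⇒rank≤ {bar i}   {zeroS}   _   = -≤+
  ≼⇒rank≤ {bar i}   {tilde j} _   = -≤+
  ≼⇒rank≤ {zeroS}   {zeroS}   _   = +≤+ z≤n
  ≼⇒rank≤ {zeroS}   {tilde j} _   = +≤+ z≤n
  ≼⇒rank≤ {tilde i} {tilde j} i≤j = +≤+ (s≤s (ℕ.≤ᵇ⇒≤ (toℕ i) (toℕ j) i≤j))

  rank≤⇒≼ : ∀ {a b : Sym n r} → rank a ℤ.≤ rank b → a ≼ b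
  rank≤⇒≼ {bar i}   {bar j}   (-≤- j≤i)       = ℕ.≤⇒≤ᵇ j≤i
  rank≤⇒≼ {bar i}   {zeroS}   _               = tt
  rank≤⇒≼ {bar i}   {tilde j} _               = tt
  rank≤⇒≼ {zeroS}   {zeroS}   _               = tt
  rank≤⇒≼ {zeroS}   {tilde j} _               = tt
  rank≤⇒≼ {tilde i} {tilde j} (+≤+ (s≤s i≤j)) = ℕ.≤⇒≤ᵇ i≤j
  rank≤⇒≼ {zeroS}   {bar j}   ()
  rank≤⇒≼ {tilde i} {bar j}   ()
  rank≤⇒≼ {tilde i} {zeroS}   (+≤+ ())

  rank-injective : ∀ {a b : Sym n r} → rank a ≡ rank b → a ≡ b
  rank-injective {bar i}   {bar j}   e = cong bar (toℕ-injective (ℤ.-[1+-injective e))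
  rank-injective {zeroS}   {zeroS}   _ = refl
  rank-injective {tilde i} {tilde j} e =
    cong tilde (toℕ-injective (ℕ.suc-injective (ℤ.+-injective e)))
  rank-injective {bar i}   {zeroS}   ()
  rank-injective {bar i}   {tilde j} ()
  rank-injective {zeroS}   {bar j}   ()
  rank-injective {zeroS}   {tilde j} ()
  rank-injective {tilde i} {bar j}   ()
  rank-injective {tilde i} {zeroS}   ()

  rank-isOrderMonomorphism : IsOrderMonomorphism _≡_ _≡_ _≼_ ℤ._≤_ rank
  rank-isOrderMonomorphism = record
    { isOrderHomomorphism = record { cong = cong rank ; mono = ≼⇒rank≤ }
    ; injective           = rank-injective
    ; cancel              = rank≤⇒≼
    }

  ≼-isTotalOrder : IsTotalOrder _≡_ (_≼_ {n} {r})
  ≼-isTotalOrder = OrderMonomorphism.isTotalOrder rank-isOrderMonomorphism ℤ.≤-isTotalOrder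

  ≼-totalOrder : TotalOrder _ _ _
  ≼-totalOrder = record { isTotalOrder = ≼-isTotalOrder }

  open TotalOrder ≼-totalOrder using (totalPreorder; antisym)

  x≼y⇒minS≡x : ∀ (a b : Sym n r) → a ≼ b → minS a b ≡ a
  x≼y⇒minS≡x a b a≼b with a ≼ᵇ b
  ... | true = refl

  y≼x⇒minS≡y : ∀ (a b : Sym n r) → b ≼ a → minS a b ≡ b
  y≼x⇒minS≡y a b b≼a with a ≼ᵇ b in a≼ᵇb
  ... | true  = antisym (subst T (sym a≼ᵇb) tt) b≼a
  ... | false = refl

  x≼y⇒maxS≡y : ∀ (a b : Sym n r) → a ≼ b → maxS a b ≡ b
  x≼y⇒maxS≡y a b a≼b with a ≼ᵇ b
  ... | true = refl

  y≼x⇒maxS≡x : ∀ (a b : Sym n r) → b ≼ a → maxS a b ≡ a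
  y≼x⇒maxS≡x a b b≼a with a ≼ᵇ b in a≼ᵇb
  ... | true  = antisym b≼a (subst T (sym a≼ᵇb) tt)
  ... | false = refl

  minS-operator : MinOperator totalPreorder
  minS-operator = record
    { _⊓_       = minS
    ; x≤y⇒x⊓y≈x = λ {a} {b} → x≼y⇒minS≡x a b
    ; x≥y⇒x⊓y≈y = λ {a} {b} → y≼x⇒minS≡y a b
    }

  maxS-operator : MaxOperator totalPreorder
  maxS-operator = record
    { _⊔_       = maxS
    ; x≤y⇒x⊔y≈y = λ {a} {b} → x≼y⇒maxS≡y a b
    ; x≥y⇒x⊔y≈x = λ {a} {b} → y≼x⇒maxS≡x a b
    }

  open import Algebra.Construct.NaturalChoice.MinMaxOp minS-operator maxS-operator
  open import Relation.Binary.Reasoning.PartialOrder (TotalOrder.poset ≼-totalOrder)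

  ≼-≺-trans : ∀ {a b c : Sym n r} → a ≼ b → b ≺ c → a ≺ c
  ≼-≺-trans a≼b b≺c = begin-strict _ ≤⟨ a≼b ⟩ _ <⟨ b≺c ⟩ _ ∎

  ≺-≼-trans : ∀ {a b c : Sym n r} → a ≺ b → b ≼ c → a ≺ c
  ≺-≼-trans a≺b b≼c = begin-strict _ <⟨ a≺b ⟩ _ ≤⟨ b≼c ⟩ _ ∎

  ≺-trans : ∀ {a b c : Sym n r} → a ≺ b → b ≺ c → a ≺ c
  ≺-trans a≺b b≺c = begin-strict _ <⟨ a≺b ⟩ _ <⟨ b≺c ⟩ _ ∎

  ⊓-closed : ∀ (P : Sym n r → Set) {a b} → P a → P b → P (minS a b)
  ⊓-closed P {a} {b} pa pb =
    [ (λ e → subst P (sym e) pa) , (λ e → subst P (sym e) pb) ]′ (⊓-sel a b)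

  ⊔-closed : ∀ (P : Sym n r → Set) {a b} → P a → P b → P (maxS a b)
  ⊔-closed P {a} {b} pa pb =
    [ (λ e → subst P (sym e) pa) , (λ e → subst P (sym e) pb) ]′ (⊔-sel a b)

  ⊓-mono-≺ : ∀ {a a' b b' : Sym n r} → a' ≺ a → b' ≺ b → minS a' b' ≺ minS a b
  ⊓-mono-≺ {a' = a'} {b' = b'} a'≺a b'≺b =
    ⊓-closed (minS a' b' ≺_) (≼-≺-trans (x⊓y≤x a' b') a'≺a) (≼-≺-trans (x⊓y≤y a' b') b'≺b)

  ⊔-mono-≺ : ∀ {a a' b b' : Sym n r} → a' ≺ a → b' ≺ b → maxS a' b' ≺ maxS a b
  ⊔-mono-≺ {a} {b = b} a'≺a b'≺b =
    ⊔-closed (_≺ maxS a b) (≺-≼-trans a'≺a (x≤x⊔y a b)) (≺-≼-trans b'≺b (x≤y⊔x a b))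

  -- Shapes of the two halves of a string

  zeroS≼ : ∀ (a : Sym n r) → NotBar a → zeroS ≼ a
  zeroS≼ (tilde _) _ = tt
  zeroS≼ zeroS     _ = tt

  ≼zeroS : ∀ (a : Sym n r) → NotTilde a → a ≼ zeroS
  ≼zeroS zeroS   _ = tt
  ≼zeroS (bar _) _ = tt

  LeftShape⇒zeroS≺ : ∀ (v : Vec (Sym n r) r) {p} → p ≤ r → LeftShape v p →
                     ∀ k → toℕ k < p → zeroS ≺ lookup v k
  LeftShape⇒zeroS≺ v {p} p≤r (decreasing , lastPositive , _) k k<p =
    go (p ∸ suc (toℕ k)) k (ℕ.m+[n∸m]≡n k<p)
    where
    go : ∀ d k → suc (toℕ k) + d ≡ p → zeroS ≺ lookup v k
    go zero    k e = lastPositive k (trans (sym (ℕ.+-identityʳ _)) e)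
    go (suc d) k e = ≺-trans (go d k' e') (decreasing k k' k'≡ (subst (_< p) (sym k'≡) 1+k<p))
      where
      1+k<p : suc (toℕ k) < p
      1+k<p = subst (suc (toℕ k) <_) e (ℕ.m<m+n (suc (toℕ k)) (s≤s z≤n))
      1+k<r : suc (toℕ k) < r
      1+k<r = ℕ.<-≤-trans 1+k<p p≤r
      k' : Fin r
      k' = fromℕ< 1+k<r
      k'≡ : toℕ k' ≡ suc (toℕ k)
      k'≡ = toℕ-fromℕ< 1+k<r
      e' : suc (toℕ k') + d ≡ p
      e' = trans (cong (λ i → suc i + d) k'≡) (trans (sym (ℕ.+-suc (suc (toℕ k)) d)) e)

  RightShape⇒≺zeroS : ∀ (v : Vec (Sym n r) (n ∸ r)) {q} → 1 ≤ q → RightShape v q →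
                      ∀ k → q ≤ suc (toℕ k) → lookup v k ≺ zeroS
  RightShape⇒≺zeroS v {q} 1≤q (_ , firstNegative , decreasing) k = go (toℕ k) k refl
    where
    go : ∀ i k → toℕ k ≡ i → q ≤ suc i → lookup v k ≺ zeroS
    go zero    k e q≤1 = firstNegative k (trans (cong suc e) (ℕ.≤-antisym 1≤q q≤1))
    go (suc i) k e q≤ with ℕ.m≤n⇒m<n∨m≡n q≤
    ... | inj₂ q≡ = firstNegative k (trans (cong suc e) (sym q≡))
    ... | inj₁ q< =
      ≺-trans (decreasing k' k k≡ (subst (λ j → q ≤ suc j) (sym k'≡) q≤1+i)) (go i k' k'≡ q≤1+i)
      where
      q≤1+i : q ≤ suc i
      q≤1+i = s≤s⁻¹ q<
      i<N : i < n ∸ r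
      i<N = ℕ.<-trans (ℕ.n<1+n i) (subst (_< n ∸ r) e (toℕ<n k))
      k' : Fin (n ∸ r)
      k' = fromℕ< i<N
      k'≡ : toℕ k' ≡ i
      k'≡ = toℕ-fromℕ< i<N
      k≡ : toℕ k ≡ suc (toℕ k')
      k≡ = trans e (cong suc (sym k'≡))

  LeftShape-⊓ : ∀ (a b : Vec (Sym n r) r) {pa pb} → pa ≤ r → pb ≤ r →
                (∀ k → NotBar (lookup a k)) → (∀ k → NotBar (lookup b k)) →
                LeftShape a pa → LeftShape b pb → LeftShape (zipWith minS a b) (pa ⊓ pb)
  LeftShape-⊓ a b {pa} {pb} pa≤r pb≤r nbA nbB sa@(decA , _ , zeroA) sb@(decB , _ , zeroB) =
    decreasing , lastPositive , zeroTail
    where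
    decreasing : ∀ k l → toℕ l ≡ suc (toℕ k) → toℕ l < pa ⊓ pb →
                 lookup (zipWith minS a b) l ≺ lookup (zipWith minS a b) k
    decreasing k l l≡ l<p rewrite lookup-zipWith minS k a b | lookup-zipWith minS l a b =
      ⊓-mono-≺ (decA k l l≡ (ℕ.m<n⊓o⇒m<n pa pb l<p)) (decB k l l≡ (ℕ.m<n⊓o⇒m<o pa pb l<p))
    lastPositive : ∀ k → suc (toℕ k) ≡ pa ⊓ pb → zeroS ≺ lookup (zipWith minS a b) k
    lastPositive k e rewrite lookup-zipWith minS k a b =
      ⊓-closed (zeroS ≺_) (LeftShape⇒zeroS≺ a pa≤r sa k (ℕ.m<n⊓o⇒m<n pa pb k<p))
                          (LeftShape⇒zeroS≺ b pb≤r sb k (ℕ.m<n⊓o⇒m<o pa pb k<p))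
      where
      k<p : toℕ k < pa ⊓ pb
      k<p = subst (toℕ k <_) e (ℕ.n<1+n (toℕ k))
    zeroTail : ∀ k → pa ⊓ pb ≤ toℕ k → lookup (zipWith minS a b) k ≡ zeroS
    zeroTail k p≤k rewrite lookup-zipWith minS k a b with m⊓n≤o⇒m≤o⊎n≤o pa pb p≤k
    ... | inj₁ pa≤k rewrite zeroA k pa≤k =
      x≼y⇒minS≡x zeroS (lookup b k) (zeroS≼ (lookup b k) (nbB k))
    ... | inj₂ pb≤k rewrite zeroB k pb≤k =
      y≼x⇒minS≡y (lookup a k) zeroS (zeroS≼ (lookup a k) (nbA k))

  LeftShape-⊔ : ∀ (a b : Vec (Sym n r) r) {pa pb} → pa ≤ r → pb ≤ r →
                LeftShape a pa → LeftShape b pb → LeftShape (zipWith maxS a b) (pa ⊔ pb)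
  LeftShape-⊔ a b {pa} {pb} pa≤r pb≤r sa@(_ , _ , zeroA) sb@(_ , _ , zeroB) =
    decreasing , lastPositive , zeroTail
    where
    max-at : Fin r → Sym n r
    max-at k = maxS (lookup a k) (lookup b k)
    positive : ∀ k → toℕ k < pa ⊔ pb → zeroS ≺ max-at k
    positive k k<p with m<n⊔o⇒m<n⊎m<o pa pb k<p
    ... | inj₁ k<pa = ≺-≼-trans (LeftShape⇒zeroS≺ a pa≤r sa k k<pa) (x≤x⊔y (lookup a k) (lookup b k))
    ... | inj₂ k<pb = ≺-≼-trans (LeftShape⇒zeroS≺ b pb≤r sb k k<pb) (x≤y⊔x (lookup a k) (lookup b k))
    below : ∀ c {pc} → LeftShape c pc → ∀ k l → toℕ l ≡ suc (toℕ k) → toℕ l < pa ⊔ pb →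
            lookup c k ≼ max-at k → lookup c l ≺ max-at k
    below c {pc} (decC , _ , zeroC) k l l≡ l<p c≼ with toℕ l ℕ.<? pc
    ... | yes l<pc = ≺-≼-trans (decC k l l≡ l<pc) c≼
    ... | no l≮pc rewrite zeroC l (ℕ.≮⇒≥ l≮pc) =
      positive k (ℕ.<-trans (subst (toℕ k <_) (sym l≡) (ℕ.n<1+n (toℕ k))) l<p)
    decreasing : ∀ k l → toℕ l ≡ suc (toℕ k) → toℕ l < pa ⊔ pb →
                 lookup (zipWith maxS a b) l ≺ lookup (zipWith maxS a b) k
    decreasing k l l≡ l<p rewrite lookup-zipWith maxS k a b | lookup-zipWith maxS l a b =
      ⊔-closed (_≺ max-at k) (below a sa k l l≡ l<p (x≤x⊔y (lookup a k) (lookup b k)))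
                             (below b sb k l l≡ l<p (x≤y⊔x (lookup a k) (lookup b k)))
    lastPositive : ∀ k → suc (toℕ k) ≡ pa ⊔ pb → zeroS ≺ lookup (zipWith maxS a b) k
    lastPositive k e rewrite lookup-zipWith maxS k a b =
      positive k (subst (toℕ k <_) e (ℕ.n<1+n (toℕ k)))
    zeroTail : ∀ k → pa ⊔ pb ≤ toℕ k → lookup (zipWith maxS a b) k ≡ zeroS
    zeroTail k p≤k rewrite lookup-zipWith maxS k a b
                         | zeroA k (ℕ.m⊔n≤o⇒m≤o pa pb p≤k) | zeroB k (ℕ.m⊔n≤o⇒n≤o pa pb p≤k) = refl

  RightShape-⊓ : ∀ (a b : Vec (Sym n r) (n ∸ r)) {qa qb} → 1 ≤ qa → 1 ≤ qb →
                 RightShape a qa → RightShape b qb → RightShape (zipWith minS a b) (qa ⊓ qb)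
  RightShape-⊓ a b {qa} {qb} 1≤qa 1≤qb ra@(zeroA , _ , _) rb@(zeroB , _ , _) =
    zeroHead , firstNegative , decreasing
    where
    min-at : Fin (n ∸ r) → Sym n r
    min-at k = minS (lookup a k) (lookup b k)
    negative : ∀ k → qa ⊓ qb ≤ suc (toℕ k) → min-at k ≺ zeroS
    negative k q≤ with m⊓n≤o⇒m≤o⊎n≤o qa qb q≤
    ... | inj₁ qa≤ = ≼-≺-trans (x⊓y≤x (lookup a k) (lookup b k)) (RightShape⇒≺zeroS a 1≤qa ra k qa≤)
    ... | inj₂ qb≤ = ≼-≺-trans (x⊓y≤y (lookup a k) (lookup b k)) (RightShape⇒≺zeroS b 1≤qb rb k qb≤)
    above : ∀ c {qc} → RightShape c qc → ∀ k l → toℕ l ≡ suc (toℕ k) → qa ⊓ qb ≤ suc (toℕ k) →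
            min-at l ≼ lookup c l → min-at l ≺ lookup c k
    above c {qc} (zeroC , _ , decC) k l l≡ q≤ ≼c with qc ℕ.≤? suc (toℕ k)
    ... | yes qc≤ = ≼-≺-trans ≼c (decC k l l≡ qc≤)
    ... | no qc≰ rewrite zeroC k (ℕ.≰⇒> qc≰) =
      negative l (ℕ.≤-trans q≤ (subst (suc (toℕ k) ≤_) (cong suc (sym l≡)) (ℕ.n≤1+n _)))
    zeroHead : ∀ k → suc (toℕ k) < qa ⊓ qb → lookup (zipWith minS a b) k ≡ zeroS
    zeroHead k 1+k<q rewrite lookup-zipWith minS k a b
                           | zeroA k (ℕ.m<n⊓o⇒m<n qa qb 1+k<q) | zeroB k (ℕ.m<n⊓o⇒m<o qa qb 1+k<q) = refl
    firstNegative : ∀ k → suc (toℕ k) ≡ qa ⊓ qb → lookup (zipWith minS a b) k ≺ zeroS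
    firstNegative k e rewrite lookup-zipWith minS k a b = negative k (ℕ.≤-reflexive (sym e))
    decreasing : ∀ k l → toℕ l ≡ suc (toℕ k) → qa ⊓ qb ≤ suc (toℕ k) →
                 lookup (zipWith minS a b) l ≺ lookup (zipWith minS a b) k
    decreasing k l l≡ q≤ rewrite lookup-zipWith minS k a b | lookup-zipWith minS l a b =
      ⊓-closed (min-at l ≺_) (above a ra k l l≡ q≤ (x⊓y≤x (lookup a l) (lookup b l)))
                             (above b rb k l l≡ q≤ (x⊓y≤y (lookup a l) (lookup b l)))

  RightShape-⊔ : ∀ (a b : Vec (Sym n r) (n ∸ r)) {qa qb} → 1 ≤ qa → 1 ≤ qb →
                 (∀ k → NotTilde (lookup a k)) → (∀ k → NotTilde (lookup b k)) →
                 RightShape a qa → RightShape b qb → RightShape (zipWith maxS a b) (qa ⊔ qb)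
  RightShape-⊔ a b {qa} {qb} 1≤qa 1≤qb ntA ntB ra@(zeroA , _ , decA) rb@(zeroB , _ , decB) =
    zeroHead , firstNegative , decreasing
    where
    zeroHead : ∀ k → suc (toℕ k) < qa ⊔ qb → lookup (zipWith maxS a b) k ≡ zeroS
    zeroHead k 1+k<q rewrite lookup-zipWith maxS k a b with m<n⊔o⇒m<n⊎m<o qa qb 1+k<q
    ... | inj₁ 1+k<qa rewrite zeroA k 1+k<qa =
      y≼x⇒maxS≡x zeroS (lookup b k) (≼zeroS (lookup b k) (ntB k))
    ... | inj₂ 1+k<qb rewrite zeroB k 1+k<qb =
      x≼y⇒maxS≡y (lookup a k) zeroS (≼zeroS (lookup a k) (ntA k))
    firstNegative : ∀ k → suc (toℕ k) ≡ qa ⊔ qb → lookup (zipWith maxS a b) k ≺ zeroS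
    firstNegative k e rewrite lookup-zipWith maxS k a b =
      ⊔-closed (_≺ zeroS) (RightShape⇒≺zeroS a 1≤qa ra k (ℕ.m⊔n≤o⇒m≤o qa qb q≤))
                          (RightShape⇒≺zeroS b 1≤qb rb k (ℕ.m⊔n≤o⇒n≤o qa qb q≤))
      where
      q≤ : qa ⊔ qb ≤ suc (toℕ k)
      q≤ = ℕ.≤-reflexive (sym e)
    decreasing : ∀ k l → toℕ l ≡ suc (toℕ k) → qa ⊔ qb ≤ suc (toℕ k) →
                 lookup (zipWith maxS a b) l ≺ lookup (zipWith maxS a b) k
    decreasing k l l≡ q≤ rewrite lookup-zipWith maxS k a b | lookup-zipWith maxS l a b =
      ⊔-mono-≺ (decA k l l≡ (ℕ.m⊔n≤o⇒m≤o qa qb q≤)) (decB k l l≡ (ℕ.m⊔n≤o⇒n≤o qa qb q≤))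

  -- The lattice S(n,r)

  IsS-meetStr : ∀ (w w' : Str n r) → IsS w → IsS w' → IsS (meetStr w w')
  IsS-meetStr w w' (nbA , ntA , (pa , pa≤r , sa) , (qa , 1≤qa , qa≤ , ra))
                  (nbB , ntB , (pb , pb≤r , sb) , (qb , 1≤qb , qb≤ , rb)) =
      zipWith-closed NotBar (⊓-closed NotBar) (left w) (left w') nbA nbB
    , zipWith-closed NotTilde (⊓-closed NotTilde) (right w) (right w') ntA ntB
    , (pa ⊓ pb , ℕ.m≤n⇒m⊓o≤n pb pa≤r , LeftShape-⊓ (left w) (left w') pa≤r pb≤r nbA nbB sa sb)
    , (qa ⊓ qb , ℕ.⊓-glb 1≤qa 1≤qb , ℕ.m≤n⇒m⊓o≤n qb qa≤
              , RightShape-⊓ (right w) (right w') 1≤qa 1≤qb ra rb)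

  IsS-joinStr : ∀ (w w' : Str n r) → IsS w → IsS w' → IsS (joinStr w w')
  IsS-joinStr w w' (nbA , ntA , (pa , pa≤r , sa) , (qa , 1≤qa , qa≤ , ra))
                  (nbB , ntB , (pb , pb≤r , sb) , (qb , 1≤qb , qb≤ , rb)) =
      zipWith-closed NotBar (⊔-closed NotBar) (left w) (left w') nbA nbB
    , zipWith-closed NotTilde (⊔-closed NotTilde) (right w) (right w') ntA ntB
    , (pa ⊔ pb , ℕ.⊔-lub pa≤r pb≤r , LeftShape-⊔ (left w) (left w') pa≤r pb≤r sa sb)
    , (qa ⊔ qb , ℕ.≤-trans 1≤qa (ℕ.m≤m⊔n qa qb) , ℕ.⊔-lub qa≤ qb≤
              , RightShape-⊔ (right w) (right w') 1≤qa 1≤qb ntA ntB ra rb)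

  ⊑-isPartialOrder : IsPartialOrder _≡_ (_⊑_ {n} {r})
  ⊑-isPartialOrder = record
    { isPreorder = record
      { isEquivalence = isEquivalence
      ; reflexive     = λ { {w} refl → L.refl {left w} , R.refl {right w} }
      ; trans         = λ { {u} {v} {w} (l₁ , r₁) (l₂ , r₂) →
                          L.trans {left u} {left v} {left w} l₁ l₂
                        , R.trans {right u} {right v} {right w} r₁ r₂ }
      }
    ; antisym = λ { {u} {v} (l₁ , r₁) (l₂ , r₂) →
                  cong₂ _∣_ (L.antisym {left u} {left v} l₁ l₂) (R.antisym {right u} {right v} r₁ r₂) }
    }
    where
    ≼-isPartialOrder = IsTotalOrder.isPartialOrder ≼-isTotalOrder
    module L = IsPartialOrder (Lookupwise-isPartialOrder ≼-isPartialOrder {r})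
    module R = IsPartialOrder (Lookupwise-isPartialOrder ≼-isPartialOrder {n ∸ r})

  joinStr-supremum : Supremum _⊑_ (joinStr {n} {r})
  joinStr-supremum w w' =
    let l₁ , l₂ , leastₗ = zipWith-supremum ⊔-supremum (left w) (left w')
        r₁ , r₂ , leastᵣ = zipWith-supremum ⊔-supremum (right w) (right w')
    in (l₁ , r₁) , (l₂ , r₂) ,
       λ { z (lz₁ , rz₁) (lz₂ , rz₂) → leastₗ (left z) lz₁ lz₂ , leastᵣ (right z) rz₁ rz₂ }
    where
    ⊔-supremum : Supremum _≼_ maxS
    ⊔-supremum a b = x≤x⊔y a b , x≤y⊔x a b , λ c → ⊔-lub {c} {a} {b}

  meetStr-infimum : Infimum _⊑_ (meetStr {n} {r})
  meetStr-infimum w w' =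
    let l₁ , l₂ , greatestₗ = zipWith-supremum ⊓-infimum (left w) (left w')
        r₁ , r₂ , greatestᵣ = zipWith-supremum ⊓-infimum (right w) (right w')
    in (l₁ , r₁) , (l₂ , r₂) ,
       λ { z (zl₁ , zr₁) (zl₂ , zr₂) → greatestₗ (left z) zl₁ zl₂ , greatestᵣ (right z) zr₁ zr₂ }
    where
    ⊓-infimum : Infimum _≼_ minS
    ⊓-infimum a b = x⊓y≤x a b , x⊓y≤y a b , λ c → ⊓-glb {c} {a} {b}

  meetStr-distribˡ-joinStr : ∀ (u v w : Str n r) →
                             meetStr u (joinStr v w) ≡ joinStr (meetStr u v) (meetStr u w)
  meetStr-distribˡ-joinStr u v w =
    cong₂ _∣_ (zipWith-distribˡ ⊓-distribˡ-⊔ (left u) (left v) (left w))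
              (zipWith-distribˡ ⊓-distribˡ-⊔ (right u) (right v) (right w))

  joinS : Op₂ (S n r)
  joinS = subtypeOp joinStr IsS-joinStr

  meetS : Op₂ (S n r)
  meetS = subtypeOp meetStr IsS-meetStr

  S-isDistributiveLattice : IsDistributiveLattice _≈S_ _⊑S_ joinS meetS
  S-isDistributiveLattice = record
    { isLattice = record
      { isPartialOrder = On.isPartialOrder proj₁ ⊑-isPartialOrder
      ; supremum       = subtype-supremum joinStr IsS-joinStr joinStr-supremum
      ; infimum        = subtype-supremum meetStr IsS-meetStr meetStr-infimum
      }
    ; ∧-distribˡ-∨ = λ x y z → meetStr-distribˡ-joinStr (proj₁ x) (proj₁ y) (proj₁ z)
    }

mainTheorem1 : (n r : ℕ) → r ≤ n →
    Σ (Op₂ (S n r)) λ _∨_ → Σ (Op₂ (S n r)) λ _∧_ →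
      IsDistributiveLattice _≈S_ _⊑S_ _∨_ _∧_
      × (∀ x y → proj₁ (x ∧ y) ≡ meetStr (proj₁ x) (proj₁ y))
      × (∀ x y → proj₁ (x ∨ y) ≡ joinStr (proj₁ x) (proj₁ y))
mainTheorem1 n r _ =
  joinS , meetS , S-isDistributiveLattice , (λ _ _ → refl) , (λ _ _ → refl)
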